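{- Let $k\geq 5$ be an integer and let $\mathcal{L}$ be a family of subsets of $[k]$ that is closed under intersection, has rank $k-1$ and is of type 2. Then there exists $S\subseteq[k]$ with $|S|=3$ such that every subset of $S$ (including $\emptyset$ and $S$) belongs to $\mathcal{L}$.
   Context: The rank of a family $\mathcal{L}$ of subsets of $[k]$ is $r(\mathcal{L})=\min\{|D|: D\subseteq[k],\ \text{no } B\in\mathcal{L}\text{ with } D\subseteq B\}$ (so rank $k-1$ forces $[k]\notin\mathcal{L}$). For an intersection-closed family $\mathcal{L}$ of proper subsets of $[k]$ of rank $k-1$, let $X=\{x\in[k]:[k]\setminus\{x\}\notin\mathcal{L}\}$; $\mathcal{L}$ is of type 1 if $|X|=1$ and of type 2 if $|X|\geq 2$. -}

module Defs where

open import Data.Nat using (ℕ; _≤_)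
open import Data.Fin using (Fin)
open import Data.Fin.Subset using (Subset; _∩_; _⊆_; ∣_∣; ⁅_⁆; ∁)
open import Data.List using (List)
open import Data.List.Membership.Propositional using (_∈_; _∉_)
open import Data.Product using (Σ; ∃; _×_)
open import Relation.Nullary using (¬_)
open import Relation.Binary.PropositionalEquality using (_≡_; _≢_)

-- A family of subsets of [k] is a (finite) list of subsets of Fin k;
-- membership B ∈ L is list membership.
Family : ℕ → Set
Family k = List (Subset k)

IntersectionClosed : ∀ {k} → Family k → Set
IntersectionClosed L = ∀ A B → A ∈ L → B ∈ L → (A ∩ B) ∈ L

Covered : ∀ {k} → Family k → Subset k → Set
Covered L D = Σ _ λ B → B ∈ L × D ⊆ B

HasRank : ∀ {k} → Family k → ℕ → Set
HasRank L r =
  (Σ _ λ D → ∣ D ∣ ≡ r × ¬ Covered L D)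
  × (∀ D → ¬ Covered L D → r ≤ ∣ D ∣)

InX : ∀ {k} → Family k → Fin k → Set
InX L x = ∁ ⁅ x ⁆ ∉ L

-- type 2: |X| ≥ 2
Type2 : ∀ {k} → Family k → Set
Type2 L = Σ _ λ x → Σ _ λ y → x ≢ y × InX L x × InX L y

module Submission where

-- Let x ≠ y be two elements of X, so neither [k]∖{x} nor
-- [k]∖{y} belongs to L.  Since L has rank k-1, every set of size at most
-- k-2 is covered by a member of L, while no member of L contains [k]∖{w}
-- for w ∈ X (such a member would be [k] itself or [k]∖{w}).  Covering
-- [k]∖{w,z} therefore yields, for w ∈ X and z ≠ w, a "separator" B ∈ L
-- with [k]∖{w,z} ⊆ B and z ∉ B.  Intersecting with separators shows that
-- the members of L avoiding x are closed under deleting single elements,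
-- hence (by a general descent lemma on finite sets) under taking subsets.
-- Finally the separators for (x,y) and (y,x) intersect to a member of L
-- avoiding x and containing [k]∖{x,y}, which has k-2 ≥ 3 elements; any
-- 3-element subset of it is the required S.

open import Defs
open import Data.Nat using (ℕ; zero; suc; _≤_; _<_; _∸_; s≤s)
open import Data.Nat.Properties using (≤-reflexive; ≤-trans; ≤-pred; n≤1+n; <⇒≱; ∸-monoˡ-≤)
open import Data.Nat.Induction using (<-wellFounded)
open import Induction.WellFounded using (Acc; acc)
open import Data.Fin using (Fin; zero; suc)
open import Data.Fin.Properties using (_≟_)
open import Data.Fin.Subset using (Subset; inside; outside; _⊆_; ∣_∣; ∁; ⁅_⁆; _∩_; _─_; _-_; ⊤; ⊥)
  renaming (_∈_ to _∈ₛ_; _∉_ to _∉ₛ_)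
open import Data.Fin.Subset.Properties
  using ( _∈?_; nonempty?; ⊆-antisym; ⊆-trans; ⊆-min; ∈⊤; ∣⊥∣≡0; in⊆in; out⊆
        ; x∈⁅x⁆; x≢y⇒x∉⁅y⁆; ∣⁅x⁆∣≡1; x∈∁p⇒x∉p; x∉p⇒x∈∁p; ∣∁p∣≡n∸∣p∣
        ; x∈p∩q⁺; x∈p∩q⁻; p─⊥≡p; p─q⊆p; x∈p∧x∉q⇒x∈p─q; _⊆?_; x∈p∧x≢y⇒x∈p-y; x∈p⇒∣p-x∣<∣p∣ )
open import Data.Vec.Base using (_∷_) renaming (here to vhere; there to vthere)
open import Data.List.Membership.Propositional using (_∈_; find; lose)
open import Data.List.Relation.Unary.Any using (any?)
open import Data.Product using (Σ; _×_; _,_; proj₁; proj₂)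
open import Relation.Nullary using (¬_; Dec; yes; no; contradiction)
open import Relation.Binary.PropositionalEquality using (_≡_; _≢_; refl; sym; trans; cong; subst)

x∈p─q⇒x∉q : ∀ {n} {x : Fin n} (p q : Subset n) → x ∈ₛ p ─ q → x ∉ₛ q
x∈p─q⇒x∉q (_ ∷ p) (outside ∷ q) vhere       ()
x∈p─q⇒x∉q (_ ∷ p) (_       ∷ q) (vthere x∈) (vthere x∈q) = x∈p─q⇒x∉q p q x∈ x∈q

x∈p-y⇒x∈p : ∀ {n} {x y : Fin n} {p : Subset n} → x ∈ₛ p - y → x ∈ₛ p
x∈p-y⇒x∈p {y = y} {p} = p─q⊆p p ⁅ y ⁆

x∈p-y⇒x≢y : ∀ {n} {x y : Fin n} {p : Subset n} → x ∈ₛ p - y → x ≢ y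
x∈p-y⇒x≢y {y = y} {p} x∈ refl = x∈p─q⇒x∉q p ⁅ y ⁆ x∈ (x∈⁅x⁆ y)

x∈∁⁅y⁆⇒x≢y : ∀ {n} {x y : Fin n} → x ∈ₛ ∁ ⁅ y ⁆ → x ≢ y
x∈∁⁅y⁆⇒x≢y {y = y} x∈ refl = x∈∁p⇒x∉p x∈ (x∈⁅x⁆ y)

x≢y⇒x∈∁⁅y⁆ : ∀ {n} {x y : Fin n} → x ≢ y → x ∈ₛ ∁ ⁅ y ⁆
x≢y⇒x∈∁⁅y⁆ x≢y = x∉p⇒x∈∁p (x≢y⇒x∉⁅y⁆ x≢y)

x∈∁⁅w⁆-z : ∀ {n} {x w z : Fin n} → x ≢ w → x ≢ z → x ∈ₛ ∁ ⁅ w ⁆ - z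
x∈∁⁅w⁆-z x≢w x≢z = x∈p∧x≢y⇒x∈p-y (x≢y⇒x∈∁⁅y⁆ x≢w) x≢z

∣∁⁅x⁆∣≡n∸1 : ∀ {n} (x : Fin n) → ∣ ∁ ⁅ x ⁆ ∣ ≡ n ∸ 1
∣∁⁅x⁆∣≡n∸1 {n} x = trans (∣∁p∣≡n∸∣p∣ ⁅ x ⁆) (cong (n ∸_) (∣⁅x⁆∣≡1 x))

∣p∣≤1+∣p-y∣ : ∀ {n} (p : Subset n) (y : Fin n) → ∣ p ∣ ≤ suc ∣ p - y ∣
∣p∣≤1+∣p-y∣ (inside  ∷ p) zero    = s≤s (≤-reflexive (cong ∣_∣ (sym (p─⊥≡p p))))
∣p∣≤1+∣p-y∣ (outside ∷ p) zero    = ≤-trans (≤-reflexive (cong ∣_∣ (sym (p─⊥≡p p)))) (n≤1+n _)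
∣p∣≤1+∣p-y∣ (inside  ∷ p) (suc y) = s≤s (∣p∣≤1+∣p-y∣ p y)
∣p∣≤1+∣p-y∣ (outside ∷ p) (suc y) = ∣p∣≤1+∣p-y∣ p y

subset-of-size : ∀ {n} (p : Subset n) m → m ≤ ∣ p ∣ → Σ (Subset n) λ S → S ⊆ p × ∣ S ∣ ≡ m
subset-of-size {n} p zero _ = ⊥ , ⊆-min p , ∣⊥∣≡0 n
subset-of-size (inside ∷ p) (suc m) (s≤s m≤∣p∣) with subset-of-size p m m≤∣p∣
... | S , S⊆p , refl = inside ∷ S , in⊆in S⊆p , refl
subset-of-size (outside ∷ p) (suc m) 1+m≤∣p∣ with subset-of-size p (suc m) 1+m≤∣p∣
... | S , S⊆p , ∣S∣≡m = outside ∷ S , out⊆ S⊆p , ∣S∣≡m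

-- Induction on ∣ D ∣: either
-- T = D, or some z ∈ D ∖ T gives T ⊆ D - z with D - z smaller.
downward-closed : ∀ {n} {ℓ} (P : Subset n → Set ℓ) → (∀ A z → P A → P (A - z)) →
                  ∀ D → P D → ∀ T → T ⊆ D → P T
downward-closed P stable D = descend D (<-wellFounded ∣ D ∣)
  where
  descend : ∀ D → Acc _<_ ∣ D ∣ → P D → ∀ T → T ⊆ D → P T
  descend D (acc smaller) PD T T⊆D with nonempty? (D ─ T)
  ... | yes (z , z∈D─T) =
    descend (D - z) (smaller (x∈p⇒∣p-x∣<∣p∣ (p─q⊆p D T z∈D─T))) (stable D z PD) T T⊆D-z
    where
    T⊆D-z : T ⊆ D - z
    T⊆D-z i∈T = x∈p∧x≢y⇒x∈p-y (T⊆D i∈T) λ { refl → x∈p─q⇒x∉q D T z∈D─T i∈T }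
  ... | no D─T-empty = subst P (⊆-antisym D⊆T T⊆D) PD
    where
    D⊆T : D ⊆ T
    D⊆T {i} i∈D with i ∈? T
    ... | yes i∈T = i∈T
    ... | no  i∉T = contradiction (i , x∈p∧x∉q⇒x∈p─q i∈D i∉T) D─T-empty

covered? : ∀ {k} (L : Family k) D → Dec (Covered L D)
covered? L D with any? (D ⊆?_) L
... | yes D⊆some = yes (find D⊆some)
... | no  D⊈any  = no λ { (B , B∈L , D⊆B) → D⊈any (lose B∈L D⊆B) }

module Rank {k : ℕ} (L : Family k) (rank : HasRank L (k ∸ 1)) where

  covered-below-rank : ∀ D → ∣ D ∣ < k ∸ 1 → Covered L D
  covered-below-rank D ∣D∣<r with covered? L D
  ... | yes covered = covered
  ... | no uncovered = contradiction (proj₂ rank D uncovered) (<⇒≱ ∣D∣<r)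

  -- For w ∈ X no member of L contains [k] ∖ {w}: such a member is either
  -- [k] (which would cover the uncovered witness of the rank) or
  -- [k] ∖ {w} itself (excluded by w ∈ X).
  coatom-uncovered : ∀ {w B} → InX L w → B ∈ L → ¬ (∁ ⁅ w ⁆ ⊆ B)
  coatom-uncovered {w} {B} w∈X B∈L ∁w⊆B with w ∈? B
  ... | yes w∈B = uncovered (B , B∈L , λ _ → ⊤⊆B ∈⊤)
    where
    uncovered : ¬ Covered L (proj₁ (proj₁ rank))
    uncovered = proj₂ (proj₂ (proj₁ rank))
    ⊤⊆B : ⊤ ⊆ B
    ⊤⊆B {i} _ with i ≟ w
    ... | yes refl = w∈B
    ... | no  i≢w  = ∁w⊆B (x≢y⇒x∈∁⁅y⁆ i≢w)
  ... | no w∉B = w∈X (subst (_∈ L) (⊆-antisym B⊆∁w ∁w⊆B) B∈L)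
    where
    B⊆∁w : B ⊆ ∁ ⁅ w ⁆
    B⊆∁w i∈B = x≢y⇒x∈∁⁅y⁆ λ { refl → w∉B i∈B }

  -- Any member covering the small set [k] ∖ {w,z} will do,
  -- since containing z as well would make it contain [k] ∖ {w}.
  Separator : Fin k → Fin k → Set
  Separator w z = Σ (Subset k) λ B → B ∈ L × ∁ ⁅ w ⁆ - z ⊆ B × z ∉ₛ B

  separator : ∀ {w z} → InX L w → z ≢ w → Separator w z
  separator {w} {z} w∈X z≢w with covered-below-rank (∁ ⁅ w ⁆ - z) small
    where
    small : ∣ ∁ ⁅ w ⁆ - z ∣ < k ∸ 1
    small = subst (∣ ∁ ⁅ w ⁆ - z ∣ <_) (∣∁⁅x⁆∣≡n∸1 w) (x∈p⇒∣p-x∣<∣p∣ (x≢y⇒x∈∁⁅y⁆ z≢w))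
  ... | B , B∈L , ∁wz⊆B = B , B∈L , ∁wz⊆B , z∉B
    where
    z∉B : z ∉ₛ B
    z∉B z∈B = coatom-uncovered w∈X B∈L ∁w⊆B
      where
      ∁w⊆B : ∁ ⁅ w ⁆ ⊆ B
      ∁w⊆B {i} i∈∁w with i ≟ z
      ... | yes refl = z∈B
      ... | no  i≢z  = ∁wz⊆B (x∈p∧x≢y⇒x∈p-y i∈∁w i≢z)

module IntersectionClosedRank {k : ℕ} (L : Family k) (closed : IntersectionClosed L)
                              (rank : HasRank L (k ∸ 1)) where

  open Rank L rank

  MemberAvoiding : Fin k → Subset k → Set
  MemberAvoiding w A = w ∉ₛ A × A ∈ L

  -- They are closed under deleting an element z: for z = w nothing
  -- changes, and otherwise A - z = A ∩ B for a separator B of (w, z).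
  delete-avoiding : ∀ {w} → InX L w → ∀ A z → MemberAvoiding w A → MemberAvoiding w (A - z)
  delete-avoiding {w} w∈X A z (w∉A , A∈L) = (λ w∈A-z → w∉A (x∈p-y⇒x∈p w∈A-z)) , A-z∈L
    where
    A-z∈L : A - z ∈ L
    A-z∈L with z ≟ w
    ... | yes refl = subst (_∈ L) (⊆-antisym A⊆A-w (p─q⊆p A ⁅ w ⁆)) A∈L
      where
      A⊆A-w : A ⊆ A - w
      A⊆A-w i∈A = x∈p∧x≢y⇒x∈p-y i∈A λ { refl → w∉A i∈A }
    ... | no z≢w with separator w∈X z≢w
    ... | B , B∈L , ∁wz⊆B , z∉B = subst (_∈ L) (⊆-antisym A∩B⊆A-z A-z⊆A∩B) (closed A B A∈L B∈L)
      where
      A∩B⊆A-z : A ∩ B ⊆ A - z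
      A∩B⊆A-z i∈A∩B with x∈p∩q⁻ A B i∈A∩B
      ... | i∈A , i∈B = x∈p∧x≢y⇒x∈p-y i∈A λ { refl → z∉B i∈B }
      A-z⊆A∩B : A - z ⊆ A ∩ B
      A-z⊆A∩B {i} i∈A-z = x∈p∩q⁺ (i∈A , ∁wz⊆B (x∈∁⁅w⁆-z (λ { refl → w∉A i∈A }) (x∈p-y⇒x≢y i∈A-z)))
        where
        i∈A : i ∈ₛ A
        i∈A = x∈p-y⇒x∈p i∈A-z

  subsets-of-avoiding : ∀ {w} → InX L w → ∀ D → MemberAvoiding w D → ∀ T → T ⊆ D → T ∈ L
  subsets-of-avoiding w∈X D avoids T T⊆D =
    proj₂ (downward-closed (MemberAvoiding _) (delete-avoiding w∈X) D avoids T T⊆D)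

  large-avoiding : ∀ {x y} → x ≢ y → InX L x → InX L y →
                   Σ (Subset k) λ D → MemberAvoiding x D × ∁ ⁅ x ⁆ - y ⊆ D
  large-avoiding {x} {y} x≢y x∈X y∈X with separator x∈X (λ y≡x → x≢y (sym y≡x))
                                         | separator y∈X x≢y
  ... | B₁ , B₁∈L , ∁xy⊆B₁ , _ | B₂ , B₂∈L , ∁yx⊆B₂ , x∉B₂ =
    B₁ ∩ B₂ , (x∉B₁∩B₂ , closed B₁ B₂ B₁∈L B₂∈L) , ∁xy⊆B₁∩B₂
    where
    x∉B₁∩B₂ : x ∉ₛ B₁ ∩ B₂
    x∉B₁∩B₂ x∈B₁∩B₂ = x∉B₂ (proj₂ (x∈p∩q⁻ B₁ B₂ x∈B₁∩B₂))
    ∁xy⊆B₁∩B₂ : ∁ ⁅ x ⁆ - y ⊆ B₁ ∩ B₂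
    ∁xy⊆B₁∩B₂ {i} i∈∁xy = x∈p∩q⁺ (∁xy⊆B₁ i∈∁xy , ∁yx⊆B₂ (x∈∁⁅w⁆-z i≢y i≢x))
      where
      i≢x : i ≢ x
      i≢x = x∈∁⁅y⁆⇒x≢y (x∈p-y⇒x∈p i∈∁xy)
      i≢y : i ≢ y
      i≢y = x∈p-y⇒x≢y i∈∁xy

three≤∣∁⁅x⁆-y∣ : ∀ {k} → 5 ≤ k → (x y : Fin k) → 3 ≤ ∣ ∁ ⁅ x ⁆ - y ∣
three≤∣∁⁅x⁆-y∣ 5≤k x y = ≤-pred (≤-trans four≤∣∁x∣ (∣p∣≤1+∣p-y∣ (∁ ⁅ x ⁆) y))
  where
  four≤∣∁x∣ : 4 ≤ ∣ ∁ ⁅ x ⁆ ∣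
  four≤∣∁x∣ = subst (4 ≤_) (sym (∣∁⁅x⁆∣≡n∸1 x)) (∸-monoˡ-≤ 1 5≤k)

lemma8p4 : (k : ℕ) → 5 ≤ k → (L : Family k) →
    IntersectionClosed L → HasRank L (k ∸ 1) → Type2 L →
    Σ (Subset k) λ S → ∣ S ∣ ≡ 3 × (∀ T → T ⊆ S → T ∈ L)
lemma8p4 k 5≤k L closed rank (x , y , x≢y , x∈X , y∈X) =
  let open IntersectionClosedRank L closed rank
      D , D-avoids-x , ∁xy⊆D = large-avoiding x≢y x∈X y∈X
      S , S⊆∁xy , ∣S∣≡3 = subset-of-size (∁ ⁅ x ⁆ - y) 3 (three≤∣∁⁅x⁆-y∣ 5≤k x y)
  in S , ∣S∣≡3 , λ T T⊆S →
       subsets-of-avoiding x∈X D D-avoids-x T (⊆-trans T⊆S (⊆-trans S⊆∁xy ∁xy⊆D))
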